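{- Let $\mathcal{E},\mathcal{E}'$ be bundle event structures with $\mathcal{E}\trianglelefteq\mathcal{E}'$. Then $\mathcal{C}(\mathcal{E})\subseteq\mathcal{C}(\mathcal{E}')$ and $\mathcal{L}(\mathcal{E})\subseteq\mathcal{L}(\mathcal{E}')$.
   Context: A bundle event structure (BES) is $\mathcal{E}=(E,\#,\mapsto,\lambda,\Phi)$: $E$ a set of events; $\#\subseteq E\times E$ irreflexive symmetric; for $x,y\subseteq E$, $x\#y$ means $e\#f$ for all $e\in x,f\in y$ with $e\neq f$; $\mapsto\subseteq\mathcal{P}(E)\times E$ with $x\mapsto e\Rightarrow x\#x$; $\lambda:E\to\Sigma$ a partial labelling; $\Phi\subseteq E$ with $\Phi\#\Phi$. Let $\mathrm{cfl}(x)=\{e\mid\exists e'\in x:e\#e'\}$. An event trace is a finite sequence $e_1\cdots e_n$ such that for each $i$, $e_i\notin\mathrm{cfl}(\{e_1,\dots,e_{i-1}\})\cup\{e_1,\dots,e_{i-1}\}$ and for each bundle $z\mapsto e_i$ there is $j<i$ with $e_j\in z$. A configuration is the set of events of an event trace; $\mathcal{C}(\mathcal{E})$ is the set of configurations. For $x\in\mathcal{C}(\mathcal{E})$ its lposet is $(x,\preceq_x,\lambda|_x)$, where $\preceq_x$ is the intersection over all event traces enumerating $x$ of the reflexive-transitive closures of their sequence orders; $\mathcal{L}(\mathcal{E})$ is the set of these lposets. Sub-BES order: $\mathcal{E}\trianglelefteq\mathcal{E}'$ iff $E\subseteq E'$, $\#=\#'\cap(E\times E)$, $\mapsto\subseteq\mapsto'$,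 ($x\mapsto'e$ and $e\in E$) implies ($x\subseteq E$ and $x\mapsto e$), $\lambda=\lambda'|_E$, $\Phi=\Phi'\cap E$. -}

module Defs where

open import Level using (Level; suc; _⊔_)
open import Data.List using (List; length; lookup)
open import Data.Fin using (Fin; _<_; _≤_)
open import Data.Maybe using (Maybe)
open import Data.Product using (Σ; _×_; _,_; ∃; ∃-syntax)
open import Relation.Nullary using (¬_)
open import Relation.Binary.PropositionalEquality using (_≡_; _≢_)
open import Function.Bundles using (_⇔_)

-- Events of all BESs live in a common universe type U (so that E ⊆ E' makes
-- sense); sets of events are predicates on U.  Σ-labels are drawn from L.

Pred : Set → Set₁
Pred U = U → Set

_⊆_ : {U : Set} → Pred U → Pred U → Set
x ⊆ y = ∀ e → x e → y e

SetConflict : {U : Set} → (U → U → Set) → Pred U → Pred U → Set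
SetConflict _#_ x y = ∀ e f → x e → y f → e ≢ f → e # f

record BES (U L : Set) : Set₁ where
  field
    Ev      : Pred U
    _#_     : U → U → Set
    _↦_     : Pred U → U → Set
    lab     : U → Maybe L                  -- partial labelling (only its values on E matter)
    Φ       : Pred U
    #-in-E  : ∀ e f → e # f → Ev e × Ev f
    #-irrefl : ∀ e → ¬ (e # e)
    #-sym   : ∀ e f → e # f → f # e
    ↦-in-E  : ∀ x e → x ↦ e → (x ⊆ Ev) × Ev e
    ↦-confl : ∀ x e → x ↦ e → SetConflict _#_ x x
    Φ-in-E  : Φ ⊆ Ev
    Φ-confl : SetConflict _#_ Φ Φ

module _ {U L : Set} (ℰ : BES U L) where
  open BES ℰ

  -- e is among the first i entries of t  (i.e. e ∈ {e_1,…,e_{i-1}} for position i)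
  Earlier : (t : List U) → Fin (length t) → U → Set
  Earlier t i e = ∃[ j ] (j < i × lookup t j ≡ e)

  IsTrace : List U → Set₁
  IsTrace t = ∀ (i : Fin (length t)) →
      Ev (lookup t i)
    × ¬ (∃[ e ] (Earlier t i e × (lookup t i # e)))
    × ¬ Earlier t i (lookup t i)
    × (∀ z → z ↦ lookup t i → ∃[ e ] (Earlier t i e × z e))

  Enumerates : List U → Pred U → Set
  Enumerates t x = ∀ e → x e ⇔ (∃[ i ] (lookup t i ≡ e))

  IsConfig : Pred U → Set₁
  IsConfig x = Σ (List U) λ t → IsTrace t × Enumerates t x

  AtOrBefore : List U → U → U → Set
  AtOrBefore t e f = ∃[ i ] ∃[ j ] (i ≤ j × lookup t i ≡ e × lookup t j ≡ f)

  Prec : Pred U → U → U → Set₁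
  Prec x e f = ∀ t → IsTrace t → Enumerates t x → AtOrBefore t e f

  LPoset : Set₂
  LPoset = Σ (Pred U) λ _ → Σ (U → U → Set₁) λ _ → (U → Maybe L)

  -- (x, ≤, l) ∈ 𝓛(ℰ): x is a configuration, ≤ is ≼_x on x, l is lab restricted to x
  -- (lposets are compared on their carrier x only)
  InL : LPoset → Set₁
  InL (x , R , l) = IsConfig x
    × (∀ e f → x e → x f → (R e f ⇔ Prec x e f))
    × (∀ e → x e → l e ≡ lab e)

record _⊴_ {U L : Set} (ℰ ℰ' : BES U L) : Set₁ where
  module A = BES ℰ
  module B = BES ℰ'
  field
    ev-⊆  : A.Ev ⊆ B.Ev
    #-eq  : ∀ e f → A.Ev e → A.Ev f → (A._#_ e f ⇔ B._#_ e f)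
    ↦-⊆   : ∀ x e → A._↦_ x e → B._↦_ x e
    ↦-ref : ∀ x e → B._↦_ x e → A.Ev e → (x ⊆ A.Ev) × A._↦_ x e
    lab-eq : ∀ e → A.Ev e → A.lab e ≡ B.lab e
    Φ-eq  : ∀ e → A.Ev e → (A.Φ e ⇔ B.Φ e)

-- Restricting to a sub-BES changes neither conflicts nor bundles among events of
-- E, so a sequence of events of E is an event trace of ℰ exactly when it is one
-- of ℰ'. Traces of ℰ are therefore traces of ℰ', giving 𝒞(ℰ) ⊆ 𝒞(ℰ'); and the
-- traces enumerating a configuration x of ℰ (whose events lie in E) are the same
-- in both structures, so ≼ₓ, hence the lposet of x, is the same as well.
module Submission where

open import Defs
open import Data.Product using (_×_; _,_; proj₁; proj₂)
open import Data.List using (lookup)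
open import Function.Bundles using (_⇔_; mk⇔; Equivalence)
open import Function.Properties.Equivalence using () renaming (trans to ⇔-trans)
open import Relation.Binary.PropositionalEquality using (refl; trans)

module _ {U L : Set} {ℰ ℰ' : BES U L} (ℰ⊴ℰ' : ℰ ⊴ ℰ') where
  open _⊴_ ℰ⊴ℰ'
  open Equivalence

  earlier-∈ : ∀ {P : Pred U} t {i e} → (∀ j → P (lookup t j)) → Earlier ℰ t i e → P e
  earlier-∈ _ t⊆P (j , _ , refl) = t⊆P j

  trace-⊴ : ∀ t → IsTrace ℰ t → IsTrace ℰ' t
  trace-⊴ t T i with T i
  ... | ev , no-confl , fresh , bundled =
      ev-⊆ _ ev
    , (λ (e , e<i , c) →
         no-confl (e , e<i , from (#-eq _ e ev (earlier-∈ t (λ j → proj₁ (T j)) e<i)) c))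
    , fresh
    , λ z z↦ → bundled z (proj₂ (↦-ref z _ z↦ ev))

  trace-⊵ : ∀ t → (∀ i → A.Ev (lookup t i)) → IsTrace ℰ' t → IsTrace ℰ t
  trace-⊵ t t⊆E T i with T i
  ... | _ , no-confl , fresh , bundled =
      t⊆E i
    , (λ (e , e<i , c) →
         no-confl (e , e<i , to (#-eq _ e (t⊆E i) (earlier-∈ t t⊆E e<i)) c))
    , fresh
    , λ z z↦ → bundled z (↦-⊆ z _ z↦)

  config-⊆-Ev : ∀ {x} → IsConfig ℰ x → x ⊆ A.Ev
  config-⊆-Ev (t , T , En) e xe with to (En e) xe
  ... | i , refl = proj₁ (T i)

  config-⊴ : ∀ {x} → IsConfig ℰ x → IsConfig ℰ' x
  config-⊴ (t , T , En) = t , trace-⊴ t T , En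

  prec-⊴ : ∀ {x e f} → IsConfig ℰ x → Prec ℰ x e f ⇔ Prec ℰ' x e f
  prec-⊴ C = mk⇔
    (λ prec t T En → prec t (trace-⊵ t (λ i → config-⊆-Ev C _ (from (En _) (i , refl))) T) En)
    (λ prec t T En → prec t (trace-⊴ t T) En)

  inL-⊴ : ∀ p → InL ℰ p → InL ℰ' p
  inL-⊴ (x , R , l) (C , R⇔≼ , l≡lab) =
      config-⊴ C
    , (λ e f xe xf → ⇔-trans (R⇔≼ e f xe xf) (prec-⊴ C))
    , λ e xe → trans (l≡lab e xe) (lab-eq e (config-⊆-Ev C e xe))

corollary1 : {U L : Set} (ℰ ℰ' : BES U L) → ℰ ⊴ ℰ' →
    (∀ x → IsConfig ℰ x → IsConfig ℰ' x) × (∀ p → InL ℰ p → InL ℰ' p)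
corollary1 ℰ ℰ' ℰ⊴ℰ' = (λ _ → config-⊴ ℰ⊴ℰ') , inL-⊴ ℰ⊴ℰ'
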